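{- Let $n,m,k$ be nonnegative integers with $0 \le m < n$ and $n = m+2k$. The number of Riordan paths of length $n$ with exactly $m$ flat steps and $k$ up steps (and hence $k$ down steps) equals $f^{(k,k,1^m)}$, the number of standard Young tableaux of shape $(k,k,1^m)$.
   Context: A Motzkin path of length $n$ is a lattice path from $(0,0)$ to $(n,0)$ using steps $U=(1,1)$, $F=(1,0)$, $D=(1,-1)$ that never goes below the $x$-axis. A Riordan path is a Motzkin path with no flat step $F$ on the $x$-axis (i.e., an $F$ may occur only when strictly more $U$'s than $D$'s precede it). For a partition $\mu$, $f^\mu$ denotes the number of standard Young tableaux of shape $\mu$; $(k,k,1^m)$ denotes the partition with two parts equal to $k$ followed by $m$ parts equal to $1$. -}

module Defs where

open import Data.Nat using (ℕ; zero; suc; _+_; _<_; _<ᵇ_; _≡ᵇ_)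
open import Data.Bool using (Bool; true; false; _∧_; _∨_; not; if_then_else_)
open import Data.List using (List; []; _∷_; length; filter; map; concat; concatMap; replicate; applyUpTo)
open import Data.Nat.ListAction using (sum)
open import Data.List.Relation.Unary.All using (All)
open import Relation.Nullary.Decidable using (does)
open import Relation.Nullary using (Dec; yes; no)
open import Data.Bool.Properties using (T?)
open import Data.Bool using (T)

data Step : Set where
  U F D : Step

words : ℕ → List (List Step)
words zero = [] ∷ []
words (suc n) = concatMap (λ w → (U ∷ w) ∷ (F ∷ w) ∷ (D ∷ w) ∷ []) (words n)

riordanFrom : ℕ → List Step → Bool
riordanFrom zero    []       = true
riordanFrom (suc h) []       = false
riordanFrom h       (U ∷ w)  = riordanFrom (suc h) w
riordanFrom zero    (F ∷ w)  = false
riordanFrom (suc h) (F ∷ w)  = riordanFrom (suc h) w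
riordanFrom zero    (D ∷ w)  = false
riordanFrom (suc h) (D ∷ w)  = riordanFrom h w

IsRiordan : List Step → Bool
IsRiordan = riordanFrom zero

count : Step → List Step → ℕ
count s [] = 0
count U (U ∷ w) = suc (count U w)
count F (F ∷ w) = suc (count F w)
count D (D ∷ w) = suc (count D w)
count s (_ ∷ w) = count s w

riordanCount : ℕ → ℕ → ℕ → ℕ
riordanCount n m k =
  length (filter (λ w → T? (IsRiordan w ∧ (count F w ≡ᵇ m) ∧ (count U w ≡ᵇ k))) (words n))

-- Standard Young tableaux
-- A shape (partition) is a list of row lengths (weakly decreasing, top row first).
-- A filling of a shape is a list of rows, row i being a list of length λ_i.

Shape : Set
Shape = List ℕ

Filling : Set
Filling = List (List ℕ)

size : Shape → ℕ
size = sum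

vals : ℕ → ℕ → List (List ℕ)
vals N zero = [] ∷ []
vals N (suc l) = concatMap (λ v → map (λ x → x ∷ v) (applyUpTo suc N)) (vals N l)

fillings : ℕ → Shape → List Filling
fillings N [] = [] ∷ []
fillings N (r ∷ λ') = concatMap (λ rest → map (λ row → row ∷ rest) (vals N r)) (fillings N λ')

strictInc : List ℕ → Bool
strictInc [] = true
strictInc (x ∷ []) = true
strictInc (x ∷ y ∷ xs) = (x <ᵇ y) ∧ strictInc (y ∷ xs)

colInc : List ℕ → List ℕ → Bool
colInc (a ∷ as) (b ∷ bs) = (a <ᵇ b) ∧ colInc as bs
colInc _ _ = true

colsInc : Filling → Bool
colsInc [] = true
colsInc (r ∷ []) = true
colsInc (r ∷ s ∷ rs) = colInc r s ∧ colsInc (s ∷ rs)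

rowsInc : Filling → Bool
rowsInc [] = true
rowsInc (r ∷ rs) = strictInc r ∧ rowsInc rs

elem : ℕ → List ℕ → Bool
elem x [] = false
elem x (y ∷ ys) = (x ≡ᵇ y) ∨ elem x ys

distinct : List ℕ → Bool
distinct [] = true
distinct (x ∷ xs) = not (elem x xs) ∧ distinct xs

entries : Filling → List ℕ
entries = concat

-- A standard Young tableau of shape λ (size N): a filling with entries in {1,…,N},
-- each used exactly once (distinct N values in {1..N}), rows increasing left to right,
-- columns increasing top to bottom.
isSYT : Filling → Bool
isSYT t = distinct (entries t) ∧ rowsInc t ∧ colsInc t

numSYT : Shape → ℕ
numSYT λ' = length (filter (λ t → T? (isSYT t)) (fillings (size λ') λ'))

hook2 : ℕ → ℕ → Shape
hook2 k m = k ∷ k ∷ replicate m 1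

module Submission where

open import Defs
open import Data.Nat using (ℕ; zero; suc; _+_; _*_; _<_; _≤_; z≤n; s≤s; z<s; _<ᵇ_; _≡ᵇ_)
open import Data.Nat.ListAction using (sum)
open import Data.Nat.Properties
open import Data.Bool using (Bool; true; false; _∧_; not; if_then_else_; T)
open import Data.Bool.Properties using (T?; T-∧; T-∨; T-≡; ∧-zeroʳ; ∧-identityʳ)
open import Data.List using (List; []; _∷_; [_]; length; map; concatMap; filter; filterᵇ; _++_; replicate; applyUpTo)
open import Data.List.Properties
  using (length-++; length-++-sucʳ; length-map; length-replicate; ++-assoc; ∷-injectiveˡ; ∷-injectiveʳ;
         map-replicate; map-cong-local; concat-map-[_]; filter-none)
open import Data.List.Relation.Unary.All as All using (All; []; _∷_)
import Data.List.Relation.Unary.All.Properties as All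
open import Data.List.Relation.Unary.Any using (here; there; any?)
open import Data.List.Relation.Unary.AllPairs as AllPairs using (AllPairs; []; _∷_)
import Data.List.Relation.Unary.AllPairs.Properties as AllPairs
open import Data.List.Relation.Unary.Unique.Propositional using (Unique)
import Data.List.Relation.Unary.Unique.Propositional.Properties as Unique
open import Data.List.Relation.Binary.Pointwise using (Pointwise; []; _∷_)
open import Data.List.Relation.Binary.Pointwise.Properties using (Pointwise-length)
open import Data.List.Relation.Binary.Subset.Propositional using (_⊆_)
open import Data.List.Relation.Binary.Disjoint.Propositional using (Disjoint)
open import Data.List.Membership.Propositional using (_∈_; _∉_)
open import Data.List.Membership.Propositional.Properties
  using (∈-map⁺; ∈-map⁻; ∈-concat⁺′; ∈-concat⁻′; ∈-++⁺ˡ; ∈-++⁺ʳ; ∈-++⁻; ∈-∃++; ∈-filter⁺; ∈-filter⁻)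
open import Data.List.Membership.DecPropositional Data.Nat.Properties._≟_ using (_∈?_)
open import Data.Product using (∃; _×_; _,_; proj₁; proj₂)
open import Data.Sum using (_⊎_; inj₁; inj₂)
open import Data.Empty using (⊥-elim)
open import Function using (_∘_; _⇔_; mk⇔; Equivalence)
open import Relation.Nullary using (¬_; yes; no; does; contradiction)
open import Relation.Nullary.Decidable using (dec-true; dec-false; does-⇔)
open import Relation.Binary.PropositionalEquality
  using (_≡_; _≢_; refl; sym; trans; cong; cong₂; subst; subst₂; module ≡-Reasoning)
open import Relation.Binary.Definitions using (DecidableEquality)
open import Data.Nat.Tactic.RingSolver using (solve-∀)

-- Read step by step, Riordan paths and Motzkin paths in which no flat step precedes the first down
-- step obey the same recurrence in the length, the starting height and the numbers of flat and up
-- steps; the recurrence of the latter passes through Motzkin paths, which split into Riordan paths and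
-- Riordan paths from one level higher with one flat step fewer. Paths of the second kind are in
-- bijection with standard Young tableaux of shape (k, k, 1^m): the positions of the up, down and flat
-- steps fill the first row, the second row and the rest of the first column. The ballot condition of a
-- Motzkin path says that the two rows increase down the columns, and the absence of flat steps before
-- the first down step says that the first column increases below the second row.

private
  variable
    A : Set

choices : List (List A) → List (List A)
choices []         = [] ∷ []
choices (xs ∷ xss) = concatMap (λ ys → map (_∷ ys) xs) (choices xss)

choices-unique : {xss : List (List A)} → All Unique xss → Unique (choices xss)
choices-unique []                                = [] ∷ []
choices-unique {A = A} {xss = xs ∷ xss} (u ∷ us) =
  Unique.concat⁺ (All.map⁺ (All.universal (λ _ → Unique.map⁺ ∷-injectiveˡ u) (choices xss)))
                 (AllPairs.map⁺ (AllPairs.map disjoint (choices-unique us)))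
  where
  disjoint : {ys zs : List A} → ys ≢ zs → Disjoint (map (_∷ ys) xs) (map (_∷ zs) xs)
  disjoint ys≢zs (p , q) with _ , _ , refl ← ∈-map⁻ _ p | _ , _ , eq ← ∈-map⁻ _ q =
    ys≢zs (∷-injectiveʳ eq)

∈-choices⁺ : {ys : List A} {xss : List (List A)} → Pointwise _∈_ ys xss → ys ∈ choices xss
∈-choices⁺ []                       = here refl
∈-choices⁺ {ys = y ∷ ys} (y∈ ∷ ys∈) = ∈-concat⁺′ (∈-map⁺ (_∷ ys) y∈) (∈-map⁺ _ (∈-choices⁺ ys∈))

∈-choices⁻ : {ys : List A} (xss : List (List A)) → ys ∈ choices xss → Pointwise _∈_ ys xss
∈-choices⁻ []         (here refl) = []
∈-choices⁻ (xs ∷ xss) p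
  with zs , ys∈zs , zs∈ ← ∈-concat⁻′ (map (λ ys → map (_∷ ys) xs) (choices xss)) p
  with tl , tl∈ , refl ← ∈-map⁻ (λ ys → map (_∷ ys) xs) zs∈
  with hd , hd∈ , refl ← ∈-map⁻ (_∷ tl) ys∈zs
  = hd∈ ∷ ∈-choices⁻ xss tl∈

Pointwise-replicate⁺ : {B : Set} {R : A → B → Set} {x : B} {ys : List A} →
                       All (λ y → R y x) ys → Pointwise R ys (replicate (length ys) x)
Pointwise-replicate⁺ []       = []
Pointwise-replicate⁺ (r ∷ rs) = r ∷ Pointwise-replicate⁺ rs

Pointwise-replicate⁻ : {B : Set} {R : A → B → Set} {x : B} {ys : List A} (n : ℕ) →
                       Pointwise R ys (replicate n x) → All (λ y → R y x) ys
Pointwise-replicate⁻ zero    []       = []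
Pointwise-replicate⁻ (suc n) (r ∷ rs) = r ∷ Pointwise-replicate⁻ n rs

length≡1⇒singleton : ∀ {xs : List A} → length xs ≡ 1 → ∃ λ x → xs ≡ [ x ]
length≡1⇒singleton {xs = x ∷ []}    refl = x , refl
length≡1⇒singleton {xs = []}        ()
length≡1⇒singleton {xs = _ ∷ _ ∷ _} ()

sum-replicate : ∀ n x → sum (replicate n x) ≡ n * x
sum-replicate zero    x = refl
sum-replicate (suc n) x = cong (x +_) (sum-replicate n x)

Unique-++⁻ : ∀ (xs : List A) {ys} → Unique (xs ++ ys) → Unique ys × Disjoint xs ys
Unique-++⁻ []       u        = u , λ ()
Unique-++⁻ (x ∷ xs) (x∉ ∷ u) with u-ys , disjoint ← Unique-++⁻ xs u =
  u-ys , λ { (here refl , x∈ys) → All.lookup (All.++⁻ʳ xs x∉) x∈ys refl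
           ; (there v∈xs , v∈ys) → disjoint (v∈xs , v∈ys) }

length-≤-⊆ : {xs ys : List A} → Unique xs → xs ⊆ ys → length xs ≤ length ys
length-≤-⊆ {xs = []}     _          _   = z≤n
length-≤-⊆ {xs = x ∷ xs} (x∉ ∷ u) xs⊆ys with ys₁ , ys₂ , refl ← ∈-∃++ (xs⊆ys (here refl)) =
  ≤-trans (s≤s (length-≤-⊆ u xs⊆ys₁++ys₂)) (≤-reflexive (sym (length-++-sucʳ ys₁ x ys₂)))
  where
  xs⊆ys₁++ys₂ : xs ⊆ ys₁ ++ ys₂
  xs⊆ys₁++ys₂ {z} z∈ with ∈-++⁻ ys₁ (xs⊆ys (there z∈))
  ... | inj₁ z∈ys₁         = ∈-++⁺ˡ z∈ys₁
  ... | inj₂ (here refl)   = ⊥-elim (All.lookup x∉ z∈ refl)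
  ... | inj₂ (there z∈ys₂) = ∈-++⁺ʳ ys₁ z∈ys₂

length-≤-retraction : {B : Set} {xs : List A} {ys : List B} (f : A → B) (g : B → A) →
                      Unique xs → (∀ {x} → x ∈ xs → f x ∈ ys) → (∀ {x} → x ∈ xs → g (f x) ≡ x) →
                      length xs ≤ length ys
length-≤-retraction {ys = ys} f g u f∈ gf≡ =
  ≤-trans (length-≤-⊆ u (λ x∈ → subst (_∈ map g ys) (gf≡ x∈) (∈-map⁺ g (f∈ x∈))))
          (≤-reflexive (length-map g ys))

⊆-by-length : DecidableEquality A → {xs ys : List A} →
              Unique xs → xs ⊆ ys → length ys ≤ length xs → ys ⊆ xs
⊆-by-length _≟_ {xs} u xs⊆ys ys≤xs {y} y∈ys with any? (y ≟_) xs
... | yes y∈xs = y∈xs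
... | no  y∉xs with ys₁ , ys₂ , refl ← ∈-∃++ y∈ys =
  contradiction ys≤xs (<⇒≱ (≤-<-trans (length-≤-⊆ u xs⊆ys₁++ys₂)
                                        (≤-reflexive (sym (length-++-sucʳ ys₁ y ys₂)))))
  where
  xs⊆ys₁++ys₂ : xs ⊆ ys₁ ++ ys₂
  xs⊆ys₁++ys₂ {z} z∈ with ∈-++⁻ ys₁ (xs⊆ys z∈)
  ... | inj₁ z∈ys₁         = ∈-++⁺ˡ z∈ys₁
  ... | inj₂ (here refl)   = contradiction z∈ y∉xs
  ... | inj₂ (there z∈ys₂) = ∈-++⁺ʳ ys₁ z∈ys₂

length-filterᵇ-∷ : ∀ (p : A → Bool) x xs →
                   length (filterᵇ p (x ∷ xs)) ≡ (if p x then 1 else 0) + length (filterᵇ p xs)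
length-filterᵇ-∷ p x xs with p x
... | true  = refl
... | false = refl

length-filterᵇ-none : ∀ (p : A → Bool) xs → (∀ x → p x ≡ false) → length (filterᵇ p xs) ≡ 0
length-filterᵇ-none p xs p≡false =
  cong length (filter-none (T? ∘ p) (All.universal (λ x → subst T (p≡false x)) xs))

Ascending : List ℕ → Set
Ascending = AllPairs _<_

Ascending⇒Unique : ∀ {xs} → Ascending xs → Unique xs
Ascending⇒Unique = AllPairs.map <⇒≢

ascending-⊆-antisym : ∀ {xs ys} → Ascending xs → Ascending ys → xs ⊆ ys → ys ⊆ xs → xs ≡ ys
ascending-⊆-antisym {[]}     {[]}     _ _ _ _ = refl
ascending-⊆-antisym {[]}     {y ∷ ys} _ _ _ ys⊆xs with () ← ys⊆xs (here refl)
ascending-⊆-antisym {x ∷ xs} {[]}     _ _ xs⊆ys _ with () ← xs⊆ys (here refl)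
ascending-⊆-antisym {x ∷ xs} {y ∷ ys} (x<xs ∷ axs) (y<ys ∷ ays) xs⊆ys ys⊆xs =
  conclude (heads-≡ (xs⊆ys (here refl)) (ys⊆xs (here refl)))
  where
  heads-≡ : x ∈ y ∷ ys → y ∈ x ∷ xs → x ≡ y
  heads-≡ (here x≡y) _            = x≡y
  heads-≡ _          (here y≡x)   = sym y≡x
  heads-≡ (there x∈) (there y∈)   = contradiction (All.lookup x<xs y∈) (<⇒≯ (All.lookup y<ys x∈))
  drop-head : ∀ {zs ws} → All (x <_) zs → zs ⊆ x ∷ ws → zs ⊆ ws
  drop-head x<zs zs⊆ z∈ with zs⊆ z∈
  ... | here refl = contradiction (All.lookup x<zs z∈) (<-irrefl refl)
  ... | there z∈ws = z∈ws
  conclude : x ≡ y → x ∷ xs ≡ y ∷ ys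
  conclude refl =
    cong (x ∷_) (ascending-⊆-antisym axs ays (drop-head x<xs (xs⊆ys ∘ there)) (drop-head y<ys (ys⊆xs ∘ there)))

interval : ℕ → ℕ → List ℕ
interval a zero    = []
interval a (suc L) = a ∷ interval (suc a) L

length-interval : ∀ a L → length (interval a L) ≡ L
length-interval a zero    = refl
length-interval a (suc L) = cong suc (length-interval (suc a) L)

∈-interval⇒≥ : ∀ {a L i} → i ∈ interval a L → a ≤ i
∈-interval⇒≥ {L = suc L} (here refl) = ≤-refl
∈-interval⇒≥ {L = suc L} (there i∈) = <⇒≤ (∈-interval⇒≥ i∈)

interval-ascending : ∀ a L → Ascending (interval a L)
interval-ascending a zero    = []
interval-ascending a (suc L) = All.tabulate ∈-interval⇒≥ ∷ interval-ascending (suc a) L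

applyUpTo≡interval : ∀ (f : ℕ → ℕ) a L → (∀ i → f i ≡ a + i) → applyUpTo f L ≡ interval a L
applyUpTo≡interval f a zero    _    = refl
applyUpTo≡interval f a (suc L) f≗a+ =
  cong₂ _∷_ (trans (f≗a+ 0) (+-identityʳ a))
            (applyUpTo≡interval (f ∘ suc) (suc a) L (λ i → trans (f≗a+ (suc i)) (+-suc a i)))

T-∧⁻ : ∀ {a b} → T (a ∧ b) → T a × T b
T-∧⁻ = Equivalence.to T-∧

T-∧⁺ : ∀ {a b} → T a × T b → T (a ∧ b)
T-∧⁺ = Equivalence.from T-∧

T-elem : ∀ x xs → T (elem x xs) ⇔ x ∈ xs
T-elem x []       = mk⇔ (λ ()) (λ ())
T-elem x (y ∷ ys) = mk⇔ to from
  where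
  to : T (elem x (y ∷ ys)) → x ∈ y ∷ ys
  to t with Equivalence.to T-∨ t
  ... | inj₁ x≡ᵇy = here (≡ᵇ⇒≡ x y x≡ᵇy)
  ... | inj₂ x∈ys = there (Equivalence.to (T-elem x ys) x∈ys)
  from : x ∈ y ∷ ys → T (elem x (y ∷ ys))
  from (here refl) = Equivalence.from T-∨ (inj₁ (≡⇒≡ᵇ x x refl))
  from (there x∈)  = Equivalence.from T-∨ (inj₂ (Equivalence.from (T-elem x ys) x∈))

T-not : ∀ b → T (not b) ⇔ (¬ T b)
T-not true  = mk⇔ (λ ()) (λ ¬t → ¬t _)
T-not false = mk⇔ (λ _ ()) _

T-distinct : ∀ xs → T (distinct xs) ⇔ Unique xs
T-distinct []       = mk⇔ (λ _ → []) _
T-distinct (x ∷ xs) = mk⇔ to from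
  where
  to : T (distinct (x ∷ xs)) → Unique (x ∷ xs)
  to t with x∉ , d ← T-∧⁻ t =
    All.¬Any⇒All¬ xs (Equivalence.to (T-not _) x∉ ∘ Equivalence.from (T-elem x xs))
    ∷ Equivalence.to (T-distinct xs) d
  from : Unique (x ∷ xs) → T (distinct (x ∷ xs))
  from (x∉ ∷ u) = T-∧⁺
    ( Equivalence.from (T-not _) (All.All¬⇒¬Any x∉ ∘ Equivalence.to (T-elem x xs))
    , Equivalence.from (T-distinct xs) u )

strictInc⇒Ascending : ∀ xs → T (strictInc xs) → Ascending xs
strictInc⇒Ascending []           _ = []
strictInc⇒Ascending (x ∷ [])     _ = [] ∷ []
strictInc⇒Ascending (x ∷ y ∷ xs) t =
  extend (<ᵇ⇒< x y (proj₁ parts)) (strictInc⇒Ascending (y ∷ xs) (proj₂ parts))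
  where
  parts : T (x <ᵇ y) × T (strictInc (y ∷ xs))
  parts = T-∧⁻ t
  extend : x < y → Ascending (y ∷ xs) → Ascending (x ∷ y ∷ xs)
  extend x<y asc@(y<xs ∷ _) = (x<y ∷ All.map (<-trans x<y) y<xs) ∷ asc

Ascending⇒strictInc : ∀ {xs} → Ascending xs → T (strictInc xs)
Ascending⇒strictInc []                         = _
Ascending⇒strictInc ([] ∷ _)                   = _
Ascending⇒strictInc ((x<y ∷ _) ∷ asc@(_ ∷ _)) = T-∧⁺ (<⇒<ᵇ x<y , Ascending⇒strictInc asc)

<⇒<ᵇ≡true : ∀ {m n} → m < n → (m <ᵇ n) ≡ true
<⇒<ᵇ≡true = Equivalence.to T-≡ ∘ <⇒<ᵇ

≤⇒<ᵇ≡false : ∀ {m n} → n ≤ m → (m <ᵇ n) ≡ false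
≤⇒<ᵇ≡false {m} {n} n≤m with m <ᵇ n in eq
... | true  = contradiction n≤m (<⇒≱ (<ᵇ⇒< m n (subst T (sym eq) _)))
... | false = refl

allSteps : List Step
allSteps = U ∷ F ∷ D ∷ []

words≡choices : ∀ n → words n ≡ choices (replicate n allSteps)
words≡choices zero    = refl
words≡choices (suc n) = cong (concatMap (λ w → (U ∷ w) ∷ (F ∷ w) ∷ (D ∷ w) ∷ [])) (words≡choices n)

words-unique : ∀ n → Unique (words n)
words-unique n rewrite words≡choices n =
  choices-unique (All.replicate⁺ n (((λ ()) ∷ (λ ()) ∷ []) ∷ ((λ ()) ∷ []) ∷ [] ∷ []))

∈-words⁺ : ∀ w → w ∈ words (length w)
∈-words⁺ w rewrite words≡choices (length w) = ∈-choices⁺ (Pointwise-replicate⁺ (All.universal ∈-allSteps w))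
  where
  ∈-allSteps : ∀ s → s ∈ allSteps
  ∈-allSteps U = here refl
  ∈-allSteps F = there (here refl)
  ∈-allSteps D = there (there (here refl))

∈-words⁻ : ∀ {n w} → w ∈ words n → length w ≡ n
∈-words⁻ {n} w∈ rewrite words≡choices n =
  trans (Pointwise-length (∈-choices⁻ (replicate n allSteps) w∈)) (length-replicate n)

vals≡choices : ∀ N l → vals N l ≡ choices (replicate l (interval 1 N))
vals≡choices N zero    = refl
vals≡choices N (suc l) =
  cong₂ (λ xs vs → concatMap (λ v → map (_∷ v) xs) vs)
        (applyUpTo≡interval suc 1 N (λ _ → refl)) (vals≡choices N l)

vals-unique : ∀ N l → Unique (vals N l)
vals-unique N l rewrite vals≡choices N l =
  choices-unique (All.replicate⁺ l (Ascending⇒Unique (interval-ascending 1 N)))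

∈-vals⁺ : ∀ {N} row → All (_∈ interval 1 N) row → row ∈ vals N (length row)
∈-vals⁺ {N} row row⊆ rewrite vals≡choices N (length row) = ∈-choices⁺ (Pointwise-replicate⁺ row⊆)

∈-vals⁻ : ∀ {N l row} → row ∈ vals N l → length row ≡ l × All (_∈ interval 1 N) row
∈-vals⁻ {N} {l} row∈ rewrite vals≡choices N l with p ← ∈-choices⁻ (replicate l (interval 1 N)) row∈ =
  trans (Pointwise-length p) (length-replicate l) , Pointwise-replicate⁻ l p

fillings≡choices : ∀ N sh → fillings N sh ≡ choices (map (vals N) sh)
fillings≡choices N []       = refl
fillings≡choices N (r ∷ sh) = cong (concatMap (λ rest → map (_∷ rest) (vals N r))) (fillings≡choices N sh)

fillings-unique : ∀ N sh → Unique (fillings N sh)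
fillings-unique N sh rewrite fillings≡choices N sh = choices-unique (All.map⁺ (All.universal (vals-unique N) sh))

length-filterᵇ-words-suc : ∀ (p : List Step → Bool) n →
  length (filterᵇ p (words (suc n)))
    ≡ length (filterᵇ (p ∘ (U ∷_)) (words n)) + length (filterᵇ (p ∘ (F ∷_)) (words n))
      + length (filterᵇ (p ∘ (D ∷_)) (words n))
length-filterᵇ-words-suc p n = byFirstStep (words n)
  where
  card : (List Step → Bool) → List (List Step) → ℕ
  card q = length ∘ filterᵇ q
  extend : List (List Step) → List (List Step)
  extend = concatMap (λ w → (U ∷ w) ∷ (F ∷ w) ∷ (D ∷ w) ∷ [])
  byFirstStep : ∀ ws → card p (extend ws) ≡ card (p ∘ (U ∷_)) ws + card (p ∘ (F ∷_)) ws + card (p ∘ (D ∷_)) ws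
  byFirstStep []       = refl
  byFirstStep (w ∷ ws) = begin
      card p ((U ∷ w) ∷ (F ∷ w) ∷ (D ∷ w) ∷ extend ws)
    ≡⟨ trans (length-filterᵇ-∷ p _ _) (cong (δ U +_)
         (trans (length-filterᵇ-∷ p _ _) (cong (δ F +_) (length-filterᵇ-∷ p _ _)))) ⟩
      δ U + (δ F + (δ D + card p (extend ws)))
    ≡⟨ cong (λ r → δ U + (δ F + (δ D + r))) (byFirstStep ws) ⟩
      δ U + (δ F + (δ D + (#U + #F + #D)))
    ≡⟨ regroup (δ U) (δ F) (δ D) #U #F #D ⟩
      (δ U + #U) + (δ F + #F) + (δ D + #D)
    ≡⟨ sym (cong₂ _+_ (cong₂ _+_ (length-filterᵇ-∷ (p ∘ (U ∷_)) w ws) (length-filterᵇ-∷ (p ∘ (F ∷_)) w ws))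
                                 (length-filterᵇ-∷ (p ∘ (D ∷_)) w ws)) ⟩
      card (p ∘ (U ∷_)) (w ∷ ws) + card (p ∘ (F ∷_)) (w ∷ ws) + card (p ∘ (D ∷_)) (w ∷ ws) ∎
    where
    open ≡-Reasoning
    δ : Step → ℕ
    δ s = if p (s ∷ w) then 1 else 0
    #U #F #D : ℕ
    #U = card (p ∘ (U ∷_)) ws
    #F = card (p ∘ (F ∷_)) ws
    #D = card (p ∘ (D ∷_)) ws
    regroup : ∀ a b c x y z → a + (b + (c + (x + y + z))) ≡ (a + x) + (b + y) + (c + z)
    regroup = solve-∀

ifSuc : (ℕ → ℕ) → ℕ → ℕ
ifSuc f zero    = 0
ifSuc f (suc k) = f k

ifSuc-cong : ∀ {f g} → (∀ x → f x ≡ g x) → ∀ k → ifSuc f k ≡ ifSuc g k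
ifSuc-cong f≗g zero    = refl
ifSuc-cong f≗g (suc k) = f≗g k

ifSuc-+ : ∀ f g k → ifSuc (λ x → f x + g x) k ≡ ifSuc f k + ifSuc g k
ifSuc-+ f g zero    = refl
ifSuc-+ f g (suc k) = refl

ifSuc-0 : ∀ {f} → (∀ x → f x ≡ 0) → ∀ k → ifSuc f k ≡ 0
ifSuc-0 f≗0 zero    = refl
ifSuc-0 f≗0 (suc k) = f≗0 k

withCounts : (List Step → Bool) → ℕ → ℕ → List Step → Bool
withCounts accepts m k w = accepts w ∧ (count F w ≡ᵇ m) ∧ (count U w ≡ᵇ k)

#accepted : (List Step → Bool) → ℕ → ℕ → ℕ → ℕ
#accepted accepts n m k = length (filterᵇ (withCounts accepts m k) (words n))

#accepted-none : ∀ {accepts} → (∀ w → accepts w ≡ false) → ∀ n m k → #accepted accepts n m k ≡ 0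
#accepted-none none n m k = length-filterᵇ-none _ (words n) (λ w → cong (_∧ _) (none w))

#accepted-suc : ∀ accepts n m k →
  #accepted accepts (suc n) m k
    ≡ ifSuc (#accepted (accepts ∘ (U ∷_)) n m) k
      + ifSuc (λ m′ → #accepted (accepts ∘ (F ∷_)) n m′ k) m
      + #accepted (accepts ∘ (D ∷_)) n m k
#accepted-suc a n m k =
  trans (length-filterᵇ-words-suc (withCounts a m k) n) (cong₂ _+_ (cong₂ _+_ (ups k) (flats m)) refl)
  where
  ups : ∀ k → length (filterᵇ (withCounts a m k ∘ (U ∷_)) (words n)) ≡ ifSuc (#accepted (a ∘ (U ∷_)) n m) k
  ups zero    = length-filterᵇ-none _ (words n)
                  (λ w → trans (cong (a (U ∷ w) ∧_) (∧-zeroʳ (count F w ≡ᵇ m))) (∧-zeroʳ (a (U ∷ w))))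
  ups (suc k) = refl
  flats : ∀ m → length (filterᵇ (withCounts a m k ∘ (F ∷_)) (words n))
                  ≡ ifSuc (λ m′ → #accepted (a ∘ (F ∷_)) n m′ k) m
  flats zero    = length-filterᵇ-none _ (words n) (λ w → ∧-zeroʳ (a (F ∷ w)))
  flats (suc m) = refl

#accepted-suc-up : ∀ accepts → (∀ w → accepts (F ∷ w) ≡ false) → (∀ w → accepts (D ∷ w) ≡ false) →
                   ∀ n m k → #accepted accepts (suc n) m k ≡ ifSuc (#accepted (accepts ∘ (U ∷_)) n m) k
#accepted-suc-up a noF noD n m k = begin
    #accepted a (suc n) m k
  ≡⟨ #accepted-suc a n m k ⟩
    up + ifSuc (λ m′ → #accepted (a ∘ (F ∷_)) n m′ k) m + #accepted (a ∘ (D ∷_)) n m k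
  ≡⟨ cong₂ (λ x y → up + x + y) (ifSuc-0 (λ m′ → #accepted-none noF n m′ k) m) (#accepted-none noD n m k) ⟩
    up + 0 + 0
  ≡⟨ trans (+-identityʳ _) (+-identityʳ up) ⟩
    up ∎
  where
  open ≡-Reasoning
  up : ℕ
  up = ifSuc (#accepted (a ∘ (U ∷_)) n m) k

motzkinFrom : ℕ → List Step → Bool
motzkinFrom h       (U ∷ w) = motzkinFrom (suc h) w
motzkinFrom h       (F ∷ w) = motzkinFrom h w
motzkinFrom zero    (D ∷ w) = false
motzkinFrom (suc h) (D ∷ w) = motzkinFrom h w
motzkinFrom zero    []      = true
motzkinFrom (suc h) []      = false

lateFlatFrom : ℕ → List Step → Bool
lateFlatFrom h       (U ∷ w) = lateFlatFrom (suc h) w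
lateFlatFrom h       (F ∷ w) = false
lateFlatFrom zero    (D ∷ w) = false
lateFlatFrom (suc h) (D ∷ w) = motzkinFrom h w
lateFlatFrom zero    []      = true
lateFlatFrom (suc h) []      = false

#Riordan : ℕ → ℕ → ℕ → ℕ → ℕ
#Riordan h = #accepted (riordanFrom h)

#Motzkin : ℕ → ℕ → ℕ → ℕ → ℕ
#Motzkin h = #accepted (motzkinFrom h)

#LateFlat : ℕ → ℕ → ℕ → ℕ → ℕ
#LateFlat h = #accepted (lateFlatFrom h)

#Riordan-suc-0 : ∀ n m k → #Riordan 0 (suc n) m k ≡ ifSuc (#Riordan 1 n m) k
#Riordan-suc-0 = #accepted-suc-up (riordanFrom 0) (λ _ → refl) (λ _ → refl)

#Riordan-suc-suc : ∀ n h m k →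
  #Riordan (suc h) (suc n) m k
    ≡ ifSuc (#Riordan (2 + h) n m) k + ifSuc (λ m′ → #Riordan (suc h) n m′ k) m + #Riordan h n m k
#Riordan-suc-suc n h = #accepted-suc (riordanFrom (suc h)) n

#Motzkin-suc : ∀ n h m k →
  #Motzkin h (suc n) m k
    ≡ ifSuc (#Motzkin (suc h) n m) k + ifSuc (λ m′ → #Motzkin h n m′ k) m + ifSuc (λ h′ → #Motzkin h′ n m k) h
#Motzkin-suc n zero    m k =
  trans (#accepted-suc (motzkinFrom 0) n m k)
        (cong (ifSuc (#Motzkin 1 n m) k + ifSuc (λ m′ → #Motzkin 0 n m′ k) m +_)
              (#accepted-none (λ _ → refl) n m k))
#Motzkin-suc n (suc h) m k = #accepted-suc (motzkinFrom (suc h)) n m k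

#LateFlat-suc-0 : ∀ n m k → #LateFlat 0 (suc n) m k ≡ ifSuc (#LateFlat 1 n m) k
#LateFlat-suc-0 = #accepted-suc-up (lateFlatFrom 0) (λ _ → refl) (λ _ → refl)

#LateFlat-suc-suc : ∀ n h m k →
  #LateFlat (suc h) (suc n) m k ≡ ifSuc (#LateFlat (2 + h) n m) k + #Motzkin h n m k
#LateFlat-suc-suc n h m k =
  trans (#accepted-suc (lateFlatFrom (suc h)) n m k)
        (cong (_+ #Motzkin h n m k)
              (trans (cong (ifSuc (#LateFlat (2 + h) n m) k +_)
                           (ifSuc-0 (λ m′ → #accepted-none (λ _ → refl) n m′ k) m))
                     (+-identityʳ _)))

-- Combinatorially: replacing the last flat step at height 0 by a down step and raising everything
-- before it maps the Motzkin paths from height h with a flat step at height 0 bijectively onto the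
-- Riordan paths from height h + 1 with one flat step fewer.
MotzkinDecomposition : ℕ → Set
MotzkinDecomposition n =
  ∀ h m k → #Motzkin h n m k ≡ #Riordan h n m k + ifSuc (λ m′ → #Riordan (suc h) n m′ k) m

motzkinDecomposition-zero : MotzkinDecomposition 0
motzkinDecomposition-zero zero    zero    zero    = refl
motzkinDecomposition-zero zero    zero    (suc k) = refl
motzkinDecomposition-zero zero    (suc m) k = refl
motzkinDecomposition-zero (suc h) zero    k = refl
motzkinDecomposition-zero (suc h) (suc m) k = refl

module _ {n} (IH : MotzkinDecomposition n) where

  private
    R M : ℕ → ℕ → ℕ → ℕ
    R h = #Riordan h n
    M h = #Motzkin h n

    ups : ∀ h m k → ifSuc (M h (suc m)) k ≡ ifSuc (R h (suc m)) k + ifSuc (R (suc h) m) k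
    ups h m k = trans (ifSuc-cong (IH h (suc m)) k) (ifSuc-+ _ _ k)

    ups-0 : ∀ h k → ifSuc (M h 0) k ≡ ifSuc (R h 0) k
    ups-0 h k = ifSuc-cong (λ k′ → trans (IH h 0 k′) (+-identityʳ _)) k

  motzkinDecomposition-suc-0 : ∀ m k →
    #Motzkin 0 (suc n) m k ≡ #Riordan 0 (suc n) m k + ifSuc (λ m′ → #Riordan 1 (suc n) m′ k) m
  motzkinDecomposition-suc-0 zero k = begin
      #Motzkin 0 (suc n) 0 k
    ≡⟨ #Motzkin-suc n 0 0 k ⟩
      ifSuc (M 1 0) k + 0 + 0
    ≡⟨ cong (λ x → x + 0 + 0) (ups-0 1 k) ⟩
      ifSuc (R 1 0) k + 0 + 0
    ≡⟨ cong (_+ 0) (trans (+-identityʳ _) (sym (#Riordan-suc-0 n 0 k))) ⟩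
      #Riordan 0 (suc n) 0 k + 0 ∎
    where open ≡-Reasoning
  motzkinDecomposition-suc-0 (suc m) k = begin
      #Motzkin 0 (suc n) (suc m) k
    ≡⟨ #Motzkin-suc n 0 (suc m) k ⟩
      ifSuc (M 1 (suc m)) k + M 0 m k + 0
    ≡⟨ cong (_+ 0) (cong₂ _+_ (ups 1 m k) (IH 0 m k)) ⟩
      (up₁ + up₂) + (stay + flat) + 0
    ≡⟨ regroup up₁ up₂ stay flat ⟩
      up₁ + (up₂ + flat + stay)
    ≡⟨ sym (cong₂ _+_ (#Riordan-suc-0 n (suc m) k) (#Riordan-suc-suc n 0 m k)) ⟩
      #Riordan 0 (suc n) (suc m) k + #Riordan 1 (suc n) m k ∎
    where
    open ≡-Reasoning
    up₁ up₂ stay flat : ℕ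
    up₁  = ifSuc (R 1 (suc m)) k
    up₂  = ifSuc (R 2 m) k
    stay = R 0 m k
    flat = ifSuc (λ m′ → R 1 m′ k) m
    regroup : ∀ a b c x → (a + b) + (c + x) + 0 ≡ a + (b + x + c)
    regroup = solve-∀

  motzkinDecomposition-suc-suc : ∀ h m k →
    #Motzkin (suc h) (suc n) m k
      ≡ #Riordan (suc h) (suc n) m k + ifSuc (λ m′ → #Riordan (2 + h) (suc n) m′ k) m
  motzkinDecomposition-suc-suc h zero k = begin
      #Motzkin (suc h) (suc n) 0 k
    ≡⟨ #Motzkin-suc n (suc h) 0 k ⟩
      ifSuc (M (2 + h) 0) k + 0 + M h 0 k
    ≡⟨ cong₂ (λ x y → x + 0 + y) (ups-0 (2 + h) k) (IH h 0 k) ⟩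
      up + 0 + (down + 0)
    ≡⟨ regroup up down ⟩
      up + 0 + down + 0
    ≡⟨ sym (cong (_+ 0) (#Riordan-suc-suc n h 0 k)) ⟩
      #Riordan (suc h) (suc n) 0 k + 0 ∎
    where
    open ≡-Reasoning
    up down : ℕ
    up   = ifSuc (R (2 + h) 0) k
    down = R h 0 k
    regroup : ∀ a c → a + 0 + (c + 0) ≡ a + 0 + c + 0
    regroup = solve-∀
  motzkinDecomposition-suc-suc h (suc m) k = begin
      #Motzkin (suc h) (suc n) (suc m) k
    ≡⟨ #Motzkin-suc n (suc h) (suc m) k ⟩
      ifSuc (M (2 + h) (suc m)) k + M (suc h) m k + M h (suc m) k
    ≡⟨ cong₂ _+_ (cong₂ _+_ (ups (2 + h) m k) (IH (suc h) m k)) (IH h (suc m) k) ⟩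
      (up₁ + up₂) + (stay + flat) + (down + stay)
    ≡⟨ regroup up₁ up₂ stay flat down ⟩
      (up₁ + stay + down) + (up₂ + flat + stay)
    ≡⟨ sym (cong₂ _+_ (#Riordan-suc-suc n h (suc m) k) (#Riordan-suc-suc n (suc h) m k)) ⟩
      #Riordan (suc h) (suc n) (suc m) k + #Riordan (2 + h) (suc n) m k ∎
    where
    open ≡-Reasoning
    up₁ up₂ stay flat down : ℕ
    up₁  = ifSuc (R (2 + h) (suc m)) k
    up₂  = ifSuc (R (3 + h) m) k
    stay = R (suc h) m k
    flat = ifSuc (λ m′ → R (2 + h) m′ k) m
    down = R h (suc m) k
    regroup : ∀ a b c x e → (a + b) + (c + x) + (e + c) ≡ (a + c + e) + (b + x + c)
    regroup = solve-∀

motzkinDecomposition : ∀ n → MotzkinDecomposition n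
motzkinDecomposition zero    = motzkinDecomposition-zero
motzkinDecomposition (suc n) zero    = motzkinDecomposition-suc-0 {n} (motzkinDecomposition n)
motzkinDecomposition (suc n) (suc h) = motzkinDecomposition-suc-suc {n} (motzkinDecomposition n) h

#LateFlat≡#Riordan : ∀ n h m k → #LateFlat h n m k ≡ #Riordan h n m k
#LateFlat≡#Riordan zero    zero    zero    zero    = refl
#LateFlat≡#Riordan zero    zero    zero    (suc k) = refl
#LateFlat≡#Riordan zero    zero    (suc m) k       = refl
#LateFlat≡#Riordan zero    (suc h) m k = refl
#LateFlat≡#Riordan (suc n) zero    m k = begin
    #LateFlat 0 (suc n) m k
  ≡⟨ #LateFlat-suc-0 n m k ⟩
    ifSuc (#LateFlat 1 n m) k
  ≡⟨ ifSuc-cong (#LateFlat≡#Riordan n 1 m) k ⟩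
    ifSuc (#Riordan 1 n m) k
  ≡⟨ sym (#Riordan-suc-0 n m k) ⟩
    #Riordan 0 (suc n) m k ∎
  where open ≡-Reasoning
#LateFlat≡#Riordan (suc n) (suc h) m k = begin
    #LateFlat (suc h) (suc n) m k
  ≡⟨ #LateFlat-suc-suc n h m k ⟩
    ifSuc (#LateFlat (2 + h) n m) k + #Motzkin h n m k
  ≡⟨ cong₂ _+_ (ifSuc-cong (#LateFlat≡#Riordan n (2 + h) m) k) (motzkinDecomposition n h m k) ⟩
    ifSuc (#Riordan (2 + h) n m) k + (#Riordan h n m k + ifSuc (λ m′ → #Riordan (suc h) n m′ k) m)
  ≡⟨ regroup (ifSuc (#Riordan (2 + h) n m) k) (#Riordan h n m k)
             (ifSuc (λ m′ → #Riordan (suc h) n m′ k) m) ⟩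
    ifSuc (#Riordan (2 + h) n m) k + ifSuc (λ m′ → #Riordan (suc h) n m′ k) m + #Riordan h n m k
  ≡⟨ sym (#Riordan-suc-suc n h m k) ⟩
    #Riordan (suc h) (suc n) m k ∎
  where
  open ≡-Reasoning
  regroup : ∀ a b c → a + (b + c) ≡ a + c + b
  regroup = solve-∀

_≟ˢ_ : DecidableEquality Step
U ≟ˢ U = yes refl
F ≟ˢ F = yes refl
D ≟ˢ D = yes refl
U ≟ˢ F = no λ ()
U ≟ˢ D = no λ ()
F ≟ˢ U = no λ ()
F ≟ˢ D = no λ ()
D ≟ˢ U = no λ ()
D ≟ˢ F = no λ ()

positions : Step → ℕ → List Step → List ℕ
positions s p []      = []
positions s p (x ∷ w) with x ≟ˢ s
... | yes _ = p ∷ positions s (suc p) w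
... | no  _ = positions s (suc p) w

length-positions : ∀ s p w → length (positions s p w) ≡ count s w
length-positions s p []      = refl
length-positions U p (U ∷ w) = cong suc (length-positions U (suc p) w)
length-positions F p (F ∷ w) = cong suc (length-positions F (suc p) w)
length-positions D p (D ∷ w) = cong suc (length-positions D (suc p) w)
length-positions U p (F ∷ w) = length-positions U (suc p) w
length-positions U p (D ∷ w) = length-positions U (suc p) w
length-positions F p (U ∷ w) = length-positions F (suc p) w
length-positions F p (D ∷ w) = length-positions F (suc p) w
length-positions D p (U ∷ w) = length-positions D (suc p) w
length-positions D p (F ∷ w) = length-positions D (suc p) w

∈-positions-∷⁻ : ∀ {s p x w i} → i ∈ positions s p (x ∷ w) → (i ≡ p × x ≡ s) ⊎ i ∈ positions s (suc p) w
∈-positions-∷⁻ {s} {x = x} i∈ with x ≟ˢ s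
∈-positions-∷⁻ (here i≡p)  | yes x≡s = inj₁ (i≡p , x≡s)
∈-positions-∷⁻ (there i∈)  | yes _   = inj₂ i∈
∈-positions-∷⁻ i∈          | no  _   = inj₂ i∈

∈-positions-∷⁺ : ∀ {s p x w i} → i ∈ positions s (suc p) w → i ∈ positions s p (x ∷ w)
∈-positions-∷⁺ {s} {x = x} i∈ with x ≟ˢ s
... | yes _ = there i∈
... | no  _ = i∈

positions-⊆-interval : ∀ s p w → positions s p w ⊆ interval p (length w)
positions-⊆-interval s p (x ∷ w) i∈ with ∈-positions-∷⁻ {s} {p} {x} {w} i∈
... | inj₁ (refl , _) = here refl
... | inj₂ i∈w        = there (positions-⊆-interval s (suc p) w i∈w)

positions-above : ∀ s p w → All (p <_) (positions s (suc p) w)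
positions-above s p w = All.tabulate (∈-interval⇒≥ ∘ positions-⊆-interval s (suc p) w)

positions-ascending : ∀ s p w → Ascending (positions s p w)
positions-ascending s p []      = []
positions-ascending s p (x ∷ w) with x ≟ˢ s
... | yes _ = positions-above s p w ∷ positions-ascending s (suc p) w
... | no  _ = positions-ascending s (suc p) w

positions-disjoint : ∀ {s s′} p w {i} → i ∈ positions s p w → i ∈ positions s′ p w → s ≡ s′
positions-disjoint {s} {s′} p (x ∷ w) i∈ i∈′
  with ∈-positions-∷⁻ {s} {p} {x} {w} i∈ | ∈-positions-∷⁻ {s′} {p} {x} {w} i∈′
... | inj₁ (_ , refl)    | inj₁ (_ , refl)    = refl
... | inj₁ (refl , _)    | inj₂ p∈′           = ⊥-elim (<-irrefl refl (All.lookup (positions-above s′ p w) p∈′))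
... | inj₂ p∈            | inj₁ (refl , _)    = ⊥-elim (<-irrefl refl (All.lookup (positions-above s p w) p∈))
... | inj₂ i∈w           | inj₂ i∈w′          = positions-disjoint (suc p) w i∈w i∈w′

-- P lists the positions of the up steps still waiting for their down step; the path is Motzkin
-- iff the steps balance and the i-th entry of P ++ ups precedes the i-th down step.
motzkinFrom-ballot : ∀ P p w → All (_< p) P →
  motzkinFrom (length P) w
    ≡ colInc (P ++ positions U p w) (positions D p w) ∧ (count U w + length P ≡ᵇ count D w)
motzkinFrom-ballot []      p []      _ = refl
motzkinFrom-ballot (_ ∷ _) p []      _ = refl
motzkinFrom-ballot P       p (U ∷ w) P<p
  with ih ← motzkinFrom-ballot (P ++ [ p ]) (suc p) w (All.++⁺ (All.map m<n⇒m<1+n P<p) (≤-refl ∷ []))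
  rewrite length-++ P {[ p ]} | +-comm (length P) 1 | ++-assoc P [ p ] (positions U (suc p) w)
        | +-suc (count U w) (length P) = ih
motzkinFrom-ballot P       p (F ∷ w) P<p = motzkinFrom-ballot P (suc p) w (All.map m<n⇒m<1+n P<p)
motzkinFrom-ballot []      p (D ∷ w) _
  rewrite +-identityʳ (count U w) | sym (length-positions U (suc p) w) =
  sym (unmatched-down (positions U (suc p) w) (positions-above U p w))
  where
  unmatched-down : ∀ {ds n} us → All (p <_) us → colInc us (p ∷ ds) ∧ (length us ≡ᵇ suc n) ≡ false
  unmatched-down []      _         = refl
  unmatched-down (u ∷ _) (p<u ∷ _) rewrite ≤⇒<ᵇ≡false (<⇒≤ p<u) = refl
motzkinFrom-ballot (x ∷ P) p (D ∷ w) (x<p ∷ P<p)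
  rewrite <⇒<ᵇ≡true x<p | +-suc (count U w) (length P) =
  motzkinFrom-ballot P (suc p) w (All.map m<n⇒m<1+n P<p)

flatsAfterFirstDown : List ℕ → List ℕ → Bool
flatsAfterFirstDown _       []      = true
flatsAfterFirstDown []      (_ ∷ _) = false
flatsAfterFirstDown (d ∷ _) (f ∷ _) = d <ᵇ f

flatsAfterFirstDown-early : ∀ {p fs} ds → All (p <_) ds → flatsAfterFirstDown ds (p ∷ fs) ≡ false
flatsAfterFirstDown-early []      _         = refl
flatsAfterFirstDown-early (d ∷ _) (p<d ∷ _) = ≤⇒<ᵇ≡false (<⇒≤ p<d)

flatsAfterFirstDown-late : ∀ {p ds} fs → All (p <_) fs → flatsAfterFirstDown (p ∷ ds) fs ≡ true
flatsAfterFirstDown-late []      _         = refl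
flatsAfterFirstDown-late (f ∷ _) (p<f ∷ _) = <⇒<ᵇ≡true p<f

lateFlatFrom≡motzkinFrom∧ : ∀ h p w →
  lateFlatFrom h w ≡ motzkinFrom h w ∧ flatsAfterFirstDown (positions D p w) (positions F p w)
lateFlatFrom≡motzkinFrom∧ zero    p []      = refl
lateFlatFrom≡motzkinFrom∧ (suc h) p []      = refl
lateFlatFrom≡motzkinFrom∧ h       p (U ∷ w) = lateFlatFrom≡motzkinFrom∧ (suc h) (suc p) w
lateFlatFrom≡motzkinFrom∧ h       p (F ∷ w) =
  sym (trans (cong (motzkinFrom h w ∧_) (flatsAfterFirstDown-early _ (positions-above D p w))) (∧-zeroʳ _))
lateFlatFrom≡motzkinFrom∧ zero    p (D ∷ w) = refl
lateFlatFrom≡motzkinFrom∧ (suc h) p (D ∷ w) =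
  sym (trans (cong (motzkinFrom h w ∧_) (flatsAfterFirstDown-late _ (positions-above F p w))) (∧-identityʳ _))

lateFlatFrom-0⇔ : ∀ w → T (lateFlatFrom 0 w) ⇔
  (T (colInc (positions U 1 w) (positions D 1 w)) × count U w ≡ count D w
    × T (flatsAfterFirstDown (positions D 1 w) (positions F 1 w)))
lateFlatFrom-0⇔ w = mk⇔ (to ∘ subst T eq) (subst T (sym eq) ∘ from)
  where
  columns late : Bool
  columns = colInc (positions U 1 w) (positions D 1 w)
  late    = flatsAfterFirstDown (positions D 1 w) (positions F 1 w)
  eq : lateFlatFrom 0 w ≡ (columns ∧ (count U w + 0 ≡ᵇ count D w)) ∧ late
  eq = trans (lateFlatFrom≡motzkinFrom∧ 0 1 w) (cong (_∧ late) (motzkinFrom-ballot [] 1 w []))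
  to : T ((columns ∧ (count U w + 0 ≡ᵇ count D w)) ∧ late) → T columns × count U w ≡ count D w × T late
  to t with ballot , t-late ← T-∧⁻ t
       with t-columns , balanced ← T-∧⁻ ballot =
    t-columns , trans (sym (+-identityʳ _)) (≡ᵇ⇒≡ _ _ balanced) , t-late
  from : T columns × count U w ≡ count D w × T late → T ((columns ∧ (count U w + 0 ≡ᵇ count D w)) ∧ late)
  from (t-columns , balanced , t-late) =
    T-∧⁺ (T-∧⁺ (t-columns , ≡⇒≡ᵇ _ _ (trans (+-identityʳ _) balanced)) , t-late)

size-hook2 : ∀ k m → size (hook2 k m) ≡ k + (k + m)
size-hook2 k m = cong (λ c → k + (k + c)) (trans (sum-replicate m 1) (*-identityʳ m))

data HookFilling (N k m : ℕ) : Filling → Set where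
  hookFilling : ∀ {r₁ r₂ C} → length r₁ ≡ k → length r₂ ≡ k → length C ≡ m →
                All (_∈ interval 1 N) r₁ → All (_∈ interval 1 N) r₂ → All (_∈ interval 1 N) C →
                HookFilling N k m (r₁ ∷ r₂ ∷ map [_] C)

∈-fillings-hook⁺ : ∀ {N k m t} → HookFilling N k m t → t ∈ fillings N (hook2 k m)
∈-fillings-hook⁺ {N} {k} (hookFilling {C = C} len₁ len₂ refl r₁⊆ r₂⊆ C⊆)
  rewrite fillings≡choices N (hook2 k (length C)) =
  ∈-choices⁺ (row len₁ r₁⊆ ∷ row len₂ r₂⊆ ∷ column⁺ C⊆)
  where
  row : ∀ {r} → length r ≡ k → All (_∈ interval 1 N) r → r ∈ vals N k
  row {r} len r⊆ = subst (λ l → r ∈ vals N l) len (∈-vals⁺ r r⊆)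
  column⁺ : ∀ {C} → All (_∈ interval 1 N) C → Pointwise _∈_ (map [_] C) (map (vals N) (replicate (length C) 1))
  column⁺ []          = []
  column⁺ (x∈ ∷ C⊆) = ∈-vals⁺ [ _ ] (x∈ ∷ []) ∷ column⁺ C⊆

singletons⁻ : ∀ {N} m {cs} → Pointwise _∈_ cs (replicate m (vals N 1)) →
              ∃ λ C → cs ≡ map [_] C × length C ≡ m × All (_∈ interval 1 N) C
singletons⁻ zero    []           = [] , refl , refl , []
singletons⁻ (suc m) {c ∷ _} (c∈ ∷ cs∈)
  with len , c⊆ ← ∈-vals⁻ c∈ | C , refl , lenC , C⊆ ← singletons⁻ m cs∈
  with x , refl ← length≡1⇒singleton {xs = c} len
  = x ∷ C , refl , cong suc lenC , All.head c⊆ ∷ C⊆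

∈-fillings-hook⁻ : ∀ {N k m t} → t ∈ fillings N (hook2 k m) → HookFilling N k m t
∈-fillings-hook⁻ {N} {k} {m} t∈ rewrite fillings≡choices N (hook2 k m)
  with r₁∈ ∷ r₂∈ ∷ cs∈ ← ∈-choices⁻ (map (vals N) (hook2 k m)) t∈
  with C , refl , lenC , C⊆ ← singletons⁻ m (subst (Pointwise _∈_ _) (map-replicate (vals N) m 1) cs∈)
  with len₁ , r₁⊆ ← ∈-vals⁻ r₁∈ | len₂ , r₂⊆ ← ∈-vals⁻ r₂∈
  = hookFilling len₁ len₂ lenC r₁⊆ r₂⊆ C⊆

record IsHookTableau (r₁ r₂ C : List ℕ) : Set where
  field
    entries-unique : Unique (r₁ ++ r₂ ++ C)
    r₁-ascending   : Ascending r₁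
    r₂-ascending   : Ascending r₂
    C-ascending    : Ascending C
    columns        : T (colInc r₁ r₂)
    corner         : T (flatsAfterFirstDown r₂ C)

colInc-[]ʳ : ∀ xs → colInc xs [] ≡ true
colInc-[]ʳ []      = refl
colInc-[]ʳ (_ ∷ _) = refl

rowsInc-singletons : ∀ C → rowsInc (map [_] C) ≡ true
rowsInc-singletons []      = refl
rowsInc-singletons (_ ∷ C) = rowsInc-singletons C

colsInc-singletons : ∀ c C → colsInc ([ c ] ∷ map [_] C) ≡ strictInc (c ∷ C)
colsInc-singletons c []       = refl
colsInc-singletons c (c′ ∷ C) = cong₂ _∧_ (∧-identityʳ _) (colsInc-singletons c′ C)

colsInc-hook : ∀ r₁ d ds C →
  colsInc (r₁ ∷ (d ∷ ds) ∷ map [_] C) ≡ colInc r₁ (d ∷ ds) ∧ flatsAfterFirstDown (d ∷ ds) C ∧ strictInc C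
colsInc-hook r₁ d ds []      = refl
colsInc-hook r₁ d ds (c ∷ C) =
  cong (colInc r₁ (d ∷ ds) ∧_)
       (cong₂ _∧_ (trans (cong ((d <ᵇ c) ∧_) (colInc-[]ʳ ds)) (∧-identityʳ _)) (colsInc-singletons c C))

-- The second row must be nonempty: colsInc ignores cells below an empty row.
isSYT-hook⇔ : ∀ r₁ r₂ C → 0 < length r₂ → T (isSYT (r₁ ∷ r₂ ∷ map [_] C)) ⇔ IsHookTableau r₁ r₂ C
isSYT-hook⇔ r₁ (d ∷ ds) C _ = mk⇔ elim intro
  where
  r₂ : List ℕ
  r₂ = d ∷ ds
  distinct≡ : distinct (entries (r₁ ∷ r₂ ∷ map [_] C)) ≡ distinct (r₁ ++ r₂ ++ C)
  distinct≡ = cong (λ c → distinct (r₁ ++ r₂ ++ c)) (concat-map-[ C ])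
  rows≡ : rowsInc (r₁ ∷ r₂ ∷ map [_] C) ≡ strictInc r₁ ∧ strictInc r₂
  rows≡ = cong (λ b → strictInc r₁ ∧ b) (trans (cong (strictInc r₂ ∧_) (rowsInc-singletons C)) (∧-identityʳ _))
  elim : T (isSYT (r₁ ∷ r₂ ∷ map [_] C)) → IsHookTableau r₁ r₂ C
  elim t with t-distinct , t-rest ← T-∧⁻ t
       with t-rows , t-cols ← T-∧⁻ t-rest
       with t-r₁ , t-r₂ ← T-∧⁻ (subst T rows≡ t-rows)
       with t-columns , t-rest′ ← T-∧⁻ (subst T (colsInc-hook r₁ d ds C) t-cols)
       with t-corner , t-C ← T-∧⁻ t-rest′ = record
    { entries-unique = Equivalence.to (T-distinct _) (subst T distinct≡ t-distinct)
    ; r₁-ascending   = strictInc⇒Ascending r₁ t-r₁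
    ; r₂-ascending   = strictInc⇒Ascending r₂ t-r₂
    ; C-ascending    = strictInc⇒Ascending C t-C
    ; columns        = t-columns
    ; corner         = t-corner
    }
  intro : IsHookTableau r₁ r₂ C → T (isSYT (r₁ ∷ r₂ ∷ map [_] C))
  intro hook = T-∧⁺
    ( subst T (sym distinct≡) (Equivalence.from (T-distinct _) entries-unique)
    , T-∧⁺
      ( subst T (sym rows≡) (T-∧⁺ (Ascending⇒strictInc r₁-ascending , Ascending⇒strictInc r₂-ascending))
      , subst T (sym (colsInc-hook r₁ d ds C))
          (T-∧⁺ (columns , T-∧⁺ (corner , Ascending⇒strictInc C-ascending))) ) )
    where open IsHookTableau hook

classify : List ℕ → List ℕ → ℕ → Step
classify us ds i = if does (i ∈? us) then U else if does (i ∈? ds) then D else F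

module _ (us ds : List ℕ) {i : ℕ} where

  classify-U : i ∈ us → classify us ds i ≡ U
  classify-U i∈us rewrite dec-true (i ∈? us) i∈us = refl

  classify-D : i ∉ us → i ∈ ds → classify us ds i ≡ D
  classify-D i∉us i∈ds rewrite dec-false (i ∈? us) i∉us | dec-true (i ∈? ds) i∈ds = refl

  classify-F : i ∉ us → i ∉ ds → classify us ds i ≡ F
  classify-F i∉us i∉ds rewrite dec-false (i ∈? us) i∉us | dec-false (i ∈? ds) i∉ds = refl

  classify≡U⇒ : classify us ds i ≡ U → i ∈ us
  classify≡U⇒ eq with i ∈? us | i ∈? ds
  ... | yes i∈us | _     = i∈us
  ... | no  _    | yes _ with () ← eq
  ... | no  _    | no  _ with () ← eq

  classify≡D⇒ : classify us ds i ≡ D → i ∈ ds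
  classify≡D⇒ eq with i ∈? us | i ∈? ds
  ... | yes _ | _        with () ← eq
  ... | no  _ | yes i∈ds = i∈ds
  ... | no  _ | no  _    with () ← eq

  classify≡F⇒ : classify us ds i ≡ F → i ∉ us × i ∉ ds
  classify≡F⇒ eq with i ∈? us | i ∈? ds
  ... | yes _    | _        with () ← eq
  ... | no  _    | yes _    with () ← eq
  ... | no  i∉us | no  i∉ds = i∉us , i∉ds

classify-cong : ∀ {us us′ ds ds′} i → (i ∈ us ⇔ i ∈ us′) → (i ∈ ds ⇔ i ∈ ds′) →
                classify us ds i ≡ classify us′ ds′ i
classify-cong i us⇔ ds⇔ =
  cong₂ (λ u d → if u then U else if d then D else F)
        (does-⇔ us⇔ (i ∈? _) (i ∈? _)) (does-⇔ ds⇔ (i ∈? _) (i ∈? _))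

toTableau : List Step → Filling
toTableau w = positions U 1 w ∷ positions D 1 w ∷ map [_] (positions F 1 w)

toWord : ℕ → Filling → List Step
toWord N (r₁ ∷ r₂ ∷ _) = map (classify r₁ r₂) (interval 1 N)
toWord N _             = []

classify-positions : ∀ p w → map (classify (positions U p w) (positions D p w)) (interval p (length w)) ≡ w
classify-positions p []      = refl
classify-positions p (x ∷ w) =
  cong₂ _∷_ (head≡ x) (trans (map-cong-local (All.tabulate tail≡)) (classify-positions (suc p) w))
  where
  p∉ : ∀ s → p ∉ positions s (suc p) w
  p∉ s p∈ = <-irrefl refl (All.lookup (positions-above s p w) p∈)
  head≡ : ∀ x → classify (positions U p (x ∷ w)) (positions D p (x ∷ w)) p ≡ x
  head≡ U = classify-U (positions U p (U ∷ w)) (positions D p (U ∷ w)) (here refl)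
  head≡ F = classify-F (positions U p (F ∷ w)) (positions D p (F ∷ w)) (p∉ U) (p∉ D)
  head≡ D = classify-D (positions U p (D ∷ w)) (positions D p (D ∷ w)) (p∉ U) (here refl)
  tail⇔ : ∀ s {i} → i ∈ interval (suc p) (length w) → i ∈ positions s p (x ∷ w) ⇔ i ∈ positions s (suc p) w
  tail⇔ s {i} i∈ = mk⇔ drop (∈-positions-∷⁺ {s} {p} {x} {w})
    where
    drop : i ∈ positions s p (x ∷ w) → i ∈ positions s (suc p) w
    drop i∈′ with ∈-positions-∷⁻ {s} {p} {x} {w} i∈′
    ... | inj₁ (refl , _) = contradiction (∈-interval⇒≥ i∈) (<-irrefl refl)
    ... | inj₂ i∈w        = i∈w
  tail≡ : ∀ {i} → i ∈ interval (suc p) (length w) →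
          classify (positions U p (x ∷ w)) (positions D p (x ∷ w)) i
            ≡ classify (positions U (suc p) w) (positions D (suc p) w) i
  tail≡ i∈ = classify-cong _ (tail⇔ U i∈) (tail⇔ D i∈)

toWord-toTableau : ∀ {N} w → length w ≡ N → toWord N (toTableau w) ≡ w
toWord-toTableau w refl = classify-positions 1 w

positions-map-interval : ∀ s (f : ℕ → Step) a L →
  positions s a (map f (interval a L)) ≡ filter (λ i → f i ≟ˢ s) (interval a L)
positions-map-interval s f a zero    = refl
positions-map-interval s f a (suc L) with f a ≟ˢ s
... | yes _ = cong (a ∷_) (positions-map-interval s f (suc a) L)
... | no  _ = positions-map-interval s f (suc a) L

module FromHookTableau {N r₁ r₂ C} (hook : IsHookTableau r₁ r₂ C)
                       (entries⊆ : r₁ ++ r₂ ++ C ⊆ interval 1 N) (N≡ : N ≡ length (r₁ ++ r₂ ++ C)) where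

  open IsHookTableau hook

  word : List Step
  word = map (classify r₁ r₂) (interval 1 N)

  private
    cover : interval 1 N ⊆ r₁ ++ r₂ ++ C
    cover = ⊆-by-length _≟_ entries-unique entries⊆ (≤-reflexive (trans (length-interval 1 N) N≡))

    r₁#r₂++C : Disjoint r₁ (r₂ ++ C)
    r₁#r₂++C = proj₂ (Unique-++⁻ r₁ entries-unique)

    r₂#C : Disjoint r₂ C
    r₂#C = proj₂ (Unique-++⁻ r₂ (proj₁ (Unique-++⁻ r₁ entries-unique)))

    ∈-word⁻ : ∀ s {i} → i ∈ positions s 1 word → i ∈ interval 1 N × classify r₁ r₂ i ≡ s
    ∈-word⁻ s i∈ =
      ∈-filter⁻ (λ i → classify r₁ r₂ i ≟ˢ s) (subst (_ ∈_) (positions-map-interval s _ 1 N) i∈)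

    ∈-word⁺ : ∀ s {i} → i ∈ r₁ ++ r₂ ++ C → classify r₁ r₂ i ≡ s → i ∈ positions s 1 word
    ∈-word⁺ s i∈ eq =
      subst (_ ∈_) (sym (positions-map-interval s _ 1 N))
            (∈-filter⁺ (λ i → classify r₁ r₂ i ≟ˢ s) (entries⊆ i∈) eq)

  positions-U : positions U 1 word ≡ r₁
  positions-U = ascending-⊆-antisym (positions-ascending U 1 word) r₁-ascending
    (classify≡U⇒ r₁ r₂ ∘ proj₂ ∘ ∈-word⁻ U)
    (λ i∈r₁ → ∈-word⁺ U (∈-++⁺ˡ i∈r₁) (classify-U r₁ r₂ i∈r₁))

  positions-D : positions D 1 word ≡ r₂
  positions-D = ascending-⊆-antisym (positions-ascending D 1 word) r₂-ascending
    (classify≡D⇒ r₁ r₂ ∘ proj₂ ∘ ∈-word⁻ D)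
    (λ i∈r₂ → ∈-word⁺ D (∈-++⁺ʳ r₁ (∈-++⁺ˡ i∈r₂))
                        (classify-D r₁ r₂ (λ i∈r₁ → r₁#r₂++C (i∈r₁ , ∈-++⁺ˡ i∈r₂)) i∈r₂))

  positions-F : positions F 1 word ≡ C
  positions-F = ascending-⊆-antisym (positions-ascending F 1 word) C-ascending flat⇒C
    (λ i∈C → ∈-word⁺ F (∈-++⁺ʳ r₁ (∈-++⁺ʳ r₂ i∈C))
                       (classify-F r₁ r₂ (λ i∈r₁ → r₁#r₂++C (i∈r₁ , ∈-++⁺ʳ r₂ i∈C))
                                         (λ i∈r₂ → r₂#C (i∈r₂ , i∈C))))
    where
    flat⇒C : ∀ {i} → i ∈ positions F 1 word → i ∈ C
    flat⇒C i∈ with i∈N , classified ← ∈-word⁻ F i∈ with i∉r₁ , i∉r₂ ← classify≡F⇒ r₁ r₂ classified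
      with ∈-++⁻ r₁ (cover i∈N)
    ... | inj₁ i∈r₁ = contradiction i∈r₁ i∉r₁
    ... | inj₂ i∈r₂++C with ∈-++⁻ r₂ i∈r₂++C
    ...   | inj₁ i∈r₂ = contradiction i∈r₂ i∉r₂
    ...   | inj₂ i∈C  = i∈C

toTableau-hookSYT : ∀ {N k m w} → 0 < k → length w ≡ N → T (withCounts (lateFlatFrom 0) m k w) →
                    HookFilling N k m (toTableau w) × T (isSYT (toTableau w))
toTableau-hookSYT {N} {k} {m} {w} 0<k refl accepted
  with t-late , t-counts ← T-∧⁻ accepted
  with t-flats , t-ups ← T-∧⁻ t-counts
  with columns , balanced , corner ← Equivalence.to (lateFlatFrom-0⇔ w) t-late =
  hookFilling #U #D #F (in-range U) (in-range D) (in-range F) ,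
  Equivalence.from (isSYT-hook⇔ _ _ _ (subst (0 <_) (sym #D) 0<k)) record
    { entries-unique = Unique.++⁺ (unique U) (Unique.++⁺ (unique D) (unique F) (disjoint λ ())) (disjoint-U-DF)
    ; r₁-ascending   = positions-ascending U 1 w
    ; r₂-ascending   = positions-ascending D 1 w
    ; C-ascending    = positions-ascending F 1 w
    ; columns        = columns
    ; corner         = corner
    }
  where
  #U : length (positions U 1 w) ≡ k
  #U = trans (length-positions U 1 w) (≡ᵇ⇒≡ _ _ t-ups)
  #D : length (positions D 1 w) ≡ k
  #D = trans (length-positions D 1 w) (trans (sym balanced) (≡ᵇ⇒≡ _ _ t-ups))
  #F : length (positions F 1 w) ≡ m
  #F = trans (length-positions F 1 w) (≡ᵇ⇒≡ _ _ t-flats)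
  in-range : ∀ s → All (_∈ interval 1 (length w)) (positions s 1 w)
  in-range s = All.tabulate (positions-⊆-interval s 1 w)
  unique : ∀ s → Unique (positions s 1 w)
  unique s = Ascending⇒Unique (positions-ascending s 1 w)
  disjoint : ∀ {s s′} → s ≢ s′ → Disjoint (positions s 1 w) (positions s′ 1 w)
  disjoint s≢s′ (i∈ , i∈′) = s≢s′ (positions-disjoint 1 w i∈ i∈′)
  disjoint-U-DF : Disjoint (positions U 1 w) (positions D 1 w ++ positions F 1 w)
  disjoint-U-DF (i∈U , i∈DF) with ∈-++⁻ (positions D 1 w) i∈DF
  ... | inj₁ i∈D = disjoint (λ ()) (i∈U , i∈D)
  ... | inj₂ i∈F = disjoint (λ ()) (i∈U , i∈F)

toWord-lateFlat : ∀ {N k m t} → N ≡ k + (k + m) → 0 < k → HookFilling N k m t → T (isSYT t) →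
                  toWord N t ∈ words N × toTableau (toWord N t) ≡ t
                    × T (withCounts (lateFlatFrom 0) m k (toWord N t))
toWord-lateFlat {N} {k} {m} N≡ 0<k (hookFilling {r₁} {r₂} {C} #r₁ #r₂ #C r₁⊆ r₂⊆ C⊆) syt =
  subst (λ L → word ∈ words L) (trans (length-map _ (interval 1 N)) (length-interval 1 N)) (∈-words⁺ word) ,
  cong₂ _∷_ positions-U (cong₂ _∷_ positions-D (cong (map [_]) positions-F)) ,
  T-∧⁺ ( Equivalence.from (lateFlatFrom-0⇔ word)
           ( subst₂ (λ r s → T (colInc r s)) (sym positions-U) (sym positions-D) columns
           , trans #U (sym #D)
           , subst₂ (λ r s → T (flatsAfterFirstDown r s)) (sym positions-D) (sym positions-F) corner )
       , T-∧⁺ (≡⇒≡ᵇ _ _ #F , ≡⇒≡ᵇ _ _ #U) )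
  where
  hook : IsHookTableau r₁ r₂ C
  hook = Equivalence.to (isSYT-hook⇔ r₁ r₂ C (subst (0 <_) (sym #r₂) 0<k)) syt
  N≡#entries : N ≡ length (r₁ ++ r₂ ++ C)
  N≡#entries =
    trans N≡ (sym (trans (length-++ r₁) (cong₂ _+_ #r₁ (trans (length-++ r₂) (cong₂ _+_ #r₂ #C)))))
  open IsHookTableau hook
  open FromHookTableau hook (All.lookup (All.++⁺ r₁⊆ (All.++⁺ r₂⊆ C⊆))) N≡#entries
  #U : count U word ≡ k
  #U = trans (sym (length-positions U 1 word)) (trans (cong length positions-U) #r₁)
  #D : count D word ≡ k
  #D = trans (sym (length-positions D 1 word)) (trans (cong length positions-D) #r₂)
  #F : count F word ≡ m
  #F = trans (sym (length-positions F 1 word)) (trans (cong length positions-F) #C)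

#LateFlat≡numSYT : ∀ k m → 0 < k → #LateFlat 0 (size (hook2 k m)) m k ≡ numSYT (hook2 k m)
#LateFlat≡numSYT k m 0<k = ≤-antisym
  (length-≤-retraction toTableau (toWord N) (Unique.filter⁺ (T? ∘ accepted) (words-unique N))
                       toTableau-∈ toWord∘toTableau)
  (length-≤-retraction (toWord N) toTableau (Unique.filter⁺ (T? ∘ isSYT) (fillings-unique N (hook2 k m)))
                       toWord-∈ toTableau∘toWord)
  where
  N : ℕ
  N = size (hook2 k m)
  accepted : List Step → Bool
  accepted = withCounts (lateFlatFrom 0) m k
  LateFlatWords : List (List Step)
  LateFlatWords = filterᵇ accepted (words N)
  HookSYTs : List Filling
  HookSYTs = filterᵇ isSYT (fillings N (hook2 k m))
  toTableau-∈ : ∀ {w} → w ∈ LateFlatWords → toTableau w ∈ HookSYTs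
  toTableau-∈ {w} w∈ with w∈N , acc ← ∈-filter⁻ (T? ∘ accepted) {xs = words N} w∈
                     with t∈ , syt ← toTableau-hookSYT {N} {k} {m} {w} 0<k (∈-words⁻ w∈N) acc =
    ∈-filter⁺ (T? ∘ isSYT) (∈-fillings-hook⁺ t∈) syt
  toWord∘toTableau : ∀ {w} → w ∈ LateFlatWords → toWord N (toTableau w) ≡ w
  toWord∘toTableau {w} w∈ =
    toWord-toTableau w (∈-words⁻ (proj₁ (∈-filter⁻ (T? ∘ accepted) {xs = words N} w∈)))
  inverse : ∀ {t} → t ∈ HookSYTs →
            toWord N t ∈ words N × toTableau (toWord N t) ≡ t × T (accepted (toWord N t))
  inverse t∈ with t∈N , syt ← ∈-filter⁻ (T? ∘ isSYT) {xs = fillings N (hook2 k m)} t∈ =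
    toWord-lateFlat (size-hook2 k m) 0<k
                    (∈-fillings-hook⁻ t∈N) syt
  toWord-∈ : ∀ {t} → t ∈ HookSYTs → toWord N t ∈ LateFlatWords
  toWord-∈ t∈ with w∈N , _ , acc ← inverse t∈ = ∈-filter⁺ (T? ∘ accepted) w∈N acc
  toTableau∘toWord : ∀ {t} → t ∈ HookSYTs → toTableau (toWord N t) ≡ t
  toTableau∘toWord = proj₁ ∘ proj₂ ∘ inverse

proposition1p2 : (n m k : ℕ) → m < n → n ≡ m + 2 * k →
    riordanCount n m k ≡ numSYT (hook2 k m)
proposition1p2 n m k m<n n≡m+2k = begin
    riordanCount n m k
  ≡⟨ sym (#LateFlat≡#Riordan n 0 m k) ⟩
    #LateFlat 0 n m k
  ≡⟨ cong (λ L → #LateFlat 0 L m k) n≡size ⟩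
    #LateFlat 0 (size (hook2 k m)) m k
  ≡⟨ #LateFlat≡numSYT k m (positive k m<n n≡m+2k) ⟩
    numSYT (hook2 k m) ∎
  where
  open ≡-Reasoning
  positive : ∀ k → m < n → n ≡ m + 2 * k → 0 < k
  positive zero    m<n refl = contradiction m<n (<-irrefl (sym (+-identityʳ m)))
  positive (suc k) _   _    = z<s
  rearrange : ∀ m k → m + 2 * k ≡ k + (k + m)
  rearrange = solve-∀
  n≡size : n ≡ size (hook2 k m)
  n≡size = trans n≡m+2k (trans (rearrange m k) (sym (size-hook2 k m)))
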